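{- Let $G=(V,E)$ be a graph with $m$ edges, maximum degree $\Delta$ and arboricity $\alpha$, and run Algorithm CleverGreedy on $G$. Then for all $i\in[m]$, writing $e_i=(u_i,v_i)$: (1) at the moment $e_i$ is colored in Phase II, the set $\{1,\dots,\deg_{G_i}(u_i)+\deg_{G_i}(v_i)-1\}\setminus\chi(N_{G_{i+1}}(e_i))$ is nonempty; and (2) $\deg_{G_i}(u_i)+\deg_{G_i}(v_i)-1\le\Delta+2\alpha-1$.
   Context: The arboricity of $G$ is the smallest integer $\alpha$ with $\lceil|E(G[S])|/(|S|-1)\rceil\le\alpha$ for all $S\subseteq V$, $|S|\ge 2$. For a graph $H$ and edge $(u,v)$ of $H$, let $\Phi_H(u,v)=\min\{\deg_H(u),\deg_H(v)\}$, and $N_H(e)$ denote the set of edges of $H$ sharing an endpoint with $e$. Algorithm CleverGreedy$(G)$: Phase I: set $G_1=G$; for $i=1,\dots,m$, let $e_i$ be an edge of $G_i$ minimizing $\Phi_{G_i}$ and set $G_{i+1}=G_i-e_i$. Phase II: start with all edges uncolored; for $i=m,m-1,\dots,1$, writing $e_i=(u_i,v_i)$, assign to $e_i$ any color in $\{1,\dots,\deg_{G_i}(u_i)+\deg_{G_i}(v_i)-1\}\setminus\chi(N_{G_{i+1}}(e_i))$, where $\chi(F)$ is the set of colors currently assigned to edges of $F$. Return $\chi$. -}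

module Defs where

open import Data.Nat using (ℕ; zero; suc; _+_; _*_; _∸_; _≤_; _<_; _⊔_)
open import Data.Nat.DivMod using (_/_)
open import Data.Fin using (Fin; toℕ)
open import Data.Fin.Properties using (_≟_)
open import Data.Fin.Subset using (Subset; ∣_∣; _∈_)
open import Data.Fin.Subset.Properties using (_∈?_)
open import Data.List using (List; length; filter; drop; lookup; foldr; map; allFin)
open import Data.List.Relation.Unary.All using (All)
open import Data.List.Relation.Unary.AllPairs using (AllPairs)
open import Data.List.Relation.Binary.Permutation.Propositional using (_↭_)
open import Data.List.Membership.Propositional renaming (_∈_ to _∈ₗ_)
open import Data.Product using (_×_; _,_; ∃)
open import Data.Sum using (_⊎_)
open import Relation.Nullary using (¬_)
open import Relation.Nullary.Decidable using (_⊎-dec_; _×-dec_)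
open import Relation.Binary.PropositionalEquality using (_≡_; _≢_)

Edge : ℕ → Set
Edge n = Fin n × Fin n

SameEdge : ∀ {n} → Edge n → Edge n → Set
SameEdge (u , v) (x , y) = (u ≡ x × v ≡ y) ⊎ (u ≡ y × v ≡ x)

record Graph (n : ℕ) : Set where
  field
    edges   : List (Edge n)
    noLoops : All (λ e → Data.Product.proj₁ e ≢ Data.Product.proj₂ e) edges
    simple  : AllPairs (λ e f → ¬ SameEdge e f) edges
open Graph public

deg : ∀ {n} → List (Edge n) → Fin n → ℕ
deg H x = length (filter (λ e → (x ≟ Data.Product.proj₁ e) ⊎-dec (x ≟ Data.Product.proj₂ e)) H)

maxDeg : ∀ {n} → Graph n → ℕ
maxDeg {n} G = foldr _⊔_ 0 (map (deg (edges G)) (allFin n))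

Φ : ∀ {n} → List (Edge n) → Edge n → ℕ
Φ H (u , v) = Data.Nat._⊓_ (deg H u) (deg H v)

-- ceiling division ⌈ a / b ⌉ (for b ≥ 1; value 0 for b = 0, never used)
ceilDiv : ℕ → ℕ → ℕ
ceilDiv a zero    = 0
ceilDiv a (suc k) = (a + k) / suc k

inducedEdges : ∀ {n} → Graph n → Subset n → ℕ
inducedEdges G S =
  length (filter (λ e → (Data.Product.proj₁ e ∈? S) ×-dec (Data.Product.proj₂ e ∈? S)) (edges G))

ArbBound : ∀ {n} → Graph n → ℕ → Set
ArbBound {n} G a = (S : Subset n) → 2 ≤ ∣ S ∣ → ceilDiv (inducedEdges G S) (∣ S ∣ ∸ 1) ≤ a

IsArboricity : ∀ {n} → Graph n → ℕ → Set
IsArboricity G α = ArbBound G α × (∀ b → ArbBound G b → α ≤ b)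

SharesEndpoint : ∀ {n} → Edge n → Edge n → Set
SharesEndpoint (u , v) (x , y) = u ≡ x ⊎ u ≡ y ⊎ v ≡ x ⊎ v ≡ y

-- Phase I of CleverGreedy, 0-indexed: ord = e_0 , … , e_{m-1} lists the edges of G,
-- G_i = drop i ord, and e_i minimizes Φ_{G_i} over the edges of G_i.
IsPhaseI : ∀ {n} → Graph n → List (Edge n) → Set
IsPhaseI G ord =
  (ord ↭ edges G) ×
  ((i : Fin (length ord)) → (f : Edge _) → f ∈ₗ drop (toℕ i) ord →
     Φ (drop (toℕ i) ord) (lookup ord i) ≤ Φ (drop (toℕ i) ord) f)

palette : ∀ {n} (ord : List (Edge n)) → Fin (length ord) → ℕ
palette ord i =
  deg (drop (toℕ i) ord) (Data.Product.proj₁ (lookup ord i))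
  + deg (drop (toℕ i) ord) (Data.Product.proj₂ (lookup ord i)) ∸ 1

-- χ is a state of Phase II just before e_i is colored: the edges e_j, j > i
-- (i.e. the edges of G_{i+1}) have been colored in the order m-1, …, i+1, each
-- e_j with a color in {1,…,palette j} different from the colors of the
-- already-colored edges of N_{G_{j+1}}(e_j).
PhaseIIStateBefore : ∀ {n} (ord : List (Edge n)) → Fin (length ord) →
                     (Fin (length ord) → ℕ) → Set
PhaseIIStateBefore ord i χ =
  (j : Fin (length ord)) → toℕ i < toℕ j →
    (1 ≤ χ j) × (χ j ≤ palette ord j) ×
    ((k : Fin (length ord)) → toℕ j < toℕ k →
       SharesEndpoint (lookup ord j) (lookup ord k) → χ j ≢ χ k)

AvailableColor : ∀ {n} (ord : List (Edge n)) → Fin (length ord) →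
                 (Fin (length ord) → ℕ) → Set
AvailableColor ord i χ =
  ∃ λ c → (1 ≤ c) × (c ≤ palette ord i) ×
    ((j : Fin (length ord)) → toℕ i < toℕ j →
       SharesEndpoint (lookup ord i) (lookup ord j) → χ j ≢ c)

-- (1) is counting: the colours to avoid are those of the edges of G_{i+1} at
-- u_i or v_i, and there are deg_{G_{i+1}} u_i + deg_{G_{i+1}} v_i of them,
-- one fewer than the palette size.
-- (2) is a degeneracy argument. Let H = G_i and d = Φ_H(e_i). Every
-- non-isolated vertex x of H lies on some edge f, so d ≤ Φ_H(f) ≤ deg_H x.
-- Summing over the set S of non-isolated vertices and using the arboricity
-- bound on G[S] ⊇ H gives d |S| ≤ 2 |E(H)| ≤ 2α (|S| - 1), so d ≤ 2α. Hence
-- deg u_i + deg v_i = max + min ≤ Δ + 2α.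
module Submission where

open import Defs
open import Data.Nat using (ℕ; zero; suc; _+_; _*_; _∸_; _≤_; _<_; _⊔_; _⊓_; z≤n; s≤s; >-nonZero)
open import Data.Nat.Properties hiding (_≟_)
open import Data.Nat.DivMod using (_/_; _%_; m≡m%n+[m/n]*n; m%n<n)
open import Algebra.Properties.CommutativeMonoid.Sum +-0-commutativeMonoid
  using (sum-syntax; sum-cong-≗; ∑-distrib-+; sum-replicate-zero)
open import Data.Bool using (true; false; if_then_else_)
open import Data.Fin using (Fin; toℕ) renaming (zero to fzero; suc to fsuc)
open import Data.Fin.Properties using (_≟_)
open import Data.Fin.Subset using (Subset; Side; inside; outside; ∣_∣) renaming (_∈_ to _∈ˢ_)
open import Data.Fin.Subset.Properties using (_∈?_)
open import Data.Vec using (tabulate)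
open import Data.Vec.Properties using (lookup∘tabulate; lookup⇒[]=)
open import Data.List using (List; []; _∷_; [_]; _++_; length; filter; drop; lookup; foldr; map)
open import Data.List.Properties using (length-filter; filter-accept; filter-all; filter-some; filter-notAll; length-++)
open import Data.List.Relation.Unary.All as All using (All)
open import Data.List.Relation.Unary.Any as Any using (here; there)
open import Data.List.Relation.Binary.Sublist.Propositional using (_⊆_)
open import Data.List.Relation.Binary.Sublist.Propositional.Properties
  using (drop-⊆; filter⁺; length-mono-≤; All-resp-⊆)
open import Data.List.Relation.Binary.Permutation.Propositional using (_↭_; ↭-sym)
open import Data.List.Relation.Binary.Permutation.Propositional.Properties
  using (↭-length; filter-↭; All-resp-↭)
open import Data.List.Membership.Propositional using (_∈_; _∉_; lose)
open import Data.List.Membership.Propositional.Properties using (∈-allFin; ∈-filter⁺; ∈-filter⁻; ∈-++⁺ˡ; ∈-++⁺ʳ)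
import Data.List.Membership.DecPropositional
open import Data.Product using (_×_; _,_; ∃; proj₁; proj₂)
open import Data.Sum using (_⊎_; inj₁; inj₂; [_,_]′; assocˡ)
open import Relation.Nullary using (Dec; yes; no; does; ¬?; contradiction)
open import Relation.Nullary.Decidable using (_⊎-dec_; _×-dec_)
open import Relation.Unary using (Decidable)
open import Relation.Binary.PropositionalEquality
  using (_≡_; _≢_; refl; sym; trans; cong; cong₂; subst; subst₂; module ≡-Reasoning)
open import Function using (_∘_)

private
  variable
    n : ℕ

module _ {A : Set} where

  drop-lookup : (xs : List A) (i : Fin (length xs)) →
                drop (toℕ i) xs ≡ lookup xs i ∷ drop (suc (toℕ i)) xs
  drop-lookup (x ∷ xs) fzero    = refl
  drop-lookup (x ∷ xs) (fsuc i) = drop-lookup xs i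

  length-filter-mono : ∀ {P : A → Set} (P? : Decidable P) {xs ys zs : List A} →
                       xs ⊆ ys → ys ↭ zs → length (filter P? xs) ≤ length (filter P? zs)
  length-filter-mono P? xs⊆ys ys↭zs = ≤-trans
    (length-mono-≤ (filter⁺ P? P? (λ { refl p → p }) xs⊆ys))
    (≤-reflexive (↭-length (filter-↭ P? ys↭zs)))

  ≤-foldr-⊔ : (f : A → ℕ) {y : A} {xs : List A} → y ∈ xs → f y ≤ foldr _⊔_ 0 (map f xs)
  ≤-foldr-⊔ f (here refl)               = m≤m⊔n _ _
  ≤-foldr-⊔ f {xs = x ∷ _} (there y∈xs) = m≤n⇒m≤o⊔n (f x) (≤-foldr-⊔ f y∈xs)

  module _ {B : Set} {P : A → Set} (P? : Decidable P) where

    valuesFrom : ℕ → (xs : List A) → (Fin (length xs) → B) → List B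
    valuesFrom _       []       f = []
    valuesFrom zero    (x ∷ xs) f with does (P? x)
    ... | true  = f fzero ∷ valuesFrom zero xs (f ∘ fsuc)
    ... | false = valuesFrom zero xs (f ∘ fsuc)
    valuesFrom (suc k) (x ∷ xs) f = valuesFrom k xs (f ∘ fsuc)

    length-valuesFrom : ∀ k (xs : List A) (f : Fin (length xs) → B) →
                        length (valuesFrom k xs f) ≡ length (filter P? (drop k xs))
    length-valuesFrom zero    []       f = refl
    length-valuesFrom (suc k) []       f = refl
    length-valuesFrom zero    (x ∷ xs) f with does (P? x)
    ... | true  = cong suc (length-valuesFrom zero xs (f ∘ fsuc))
    ... | false = length-valuesFrom zero xs (f ∘ fsuc)
    length-valuesFrom (suc k) (x ∷ xs) f = length-valuesFrom k xs (f ∘ fsuc)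

    ∈-valuesFrom : ∀ k (xs : List A) (f : Fin (length xs) → B) (j : Fin (length xs)) →
                   k ≤ toℕ j → P (lookup xs j) → f j ∈ valuesFrom k xs f
    ∈-valuesFrom zero (x ∷ xs) f fzero _ p with P? x
    ... | yes _ = here refl
    ... | no ¬p = contradiction p ¬p
    ∈-valuesFrom zero (x ∷ xs) f (fsuc j) _ p with P? x
    ... | yes _ = there (∈-valuesFrom zero xs (f ∘ fsuc) j z≤n p)
    ... | no _  = ∈-valuesFrom zero xs (f ∘ fsuc) j z≤n p
    ∈-valuesFrom (suc k) (x ∷ xs) f (fsuc j) (s≤s k≤j) p =
      ∈-valuesFrom k xs (f ∘ fsuc) j k≤j p

module NatMembership = Data.List.Membership.DecPropositional Data.Nat._≟_

fresh-in-range : ∀ N (B : List ℕ) → length B < N → ∃ λ c → 1 ≤ c × c ≤ N × c ∉ B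
fresh-in-range (suc N) B |B|≤N with NatMembership._∈?_ (suc N) B
... | no  1+N∉B = suc N , s≤s z≤n , ≤-refl , 1+N∉B
... | yes 1+N∈B with fresh-in-range N B′ (≤-trans B′-shorter (≤-pred |B|≤N))
  where
  B′ = filter (λ y → ¬? (y Data.Nat.≟ suc N)) B
  B′-shorter : length B′ < length B
  B′-shorter = filter-notAll _ B (Any.map (λ { refl ne → ne refl }) 1+N∈B)
...   | c , 1≤c , c≤N , c∉B′ =
  c , 1≤c , m≤n⇒m≤1+n c≤N ,
  λ c∈B → c∉B′ (∈-filter⁺ _ c∈B (λ c≡1+N → <-irrefl c≡1+N (s≤s c≤N)))

ceilDiv≤⇒≤* : ∀ a {b} α → 1 ≤ b → ceilDiv a b ≤ α → a ≤ α * b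
ceilDiv≤⇒≤* a {suc k} α _ q≤α = +-cancelʳ-≤ k a (α * suc k) (begin
  a + k                                       ≡⟨ m≡m%n+[m/n]*n (a + k) (suc k) ⟩
  (a + k) % suc k + (a + k) / suc k * suc k   ≤⟨ +-mono-≤ (≤-pred (m%n<n (a + k) (suc k)))
                                                          (*-monoˡ-≤ (suc k) q≤α) ⟩
  k + α * suc k                               ≡⟨ +-comm k (α * suc k) ⟩
  α * suc k + k                               ∎)
  where open ≤-Reasoning

m≤o⇒n≤o⇒m⊓n≤p⇒m+n≤o+p : ∀ {m n o p} → m ≤ o → n ≤ o → m ⊓ n ≤ p → m + n ≤ o + p
m≤o⇒n≤o⇒m⊓n≤p⇒m+n≤o+p {m} {n} {o} {p} m≤o n≤o m⊓n≤p with ≤-total m n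
... | inj₁ m≤n = subst (_≤ o + p) (+-comm n m)
                   (+-mono-≤ n≤o (subst (_≤ p) (m≤n⇒m⊓n≡m m≤n) m⊓n≤p))
... | inj₂ n≤m = +-mono-≤ m≤o (subst (_≤ p) (m≥n⇒m⊓n≡n n≤m) m⊓n≤p)

indicator : Fin n → Fin n → ℕ
indicator w x = if does (x ≟ w) then 1 else 0

∑-indicator : ∀ n (w : Fin n) → ∑[ x < n ] indicator w x ≡ 1
∑-indicator (suc n) fzero    = cong suc (sum-replicate-zero n)
∑-indicator (suc n) (fsuc w) = ∑-indicator n w

isPositive : ℕ → Side
isPositive zero    = outside
isPositive (suc _) = inside

support : (Fin n → ℕ) → Subset n
support f = tabulate (isPositive ∘ f)

∈-support : (f : Fin n → ℕ) {x : Fin n} → 1 ≤ f x → x ∈ˢ support f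
∈-support f {x} 1≤fx = lookup⇒[]= x (support f) (trans (lookup∘tabulate _ x) (positive 1≤fx))
  where
  positive : ∀ {a} → 1 ≤ a → isPositive a ≡ inside
  positive (s≤s _) = refl

*∣support∣≤∑ : ∀ n d (f : Fin n → ℕ) → (∀ x → 1 ≤ f x → d ≤ f x) →
               d * ∣ support f ∣ ≤ ∑[ x < n ] f x
*∣support∣≤∑ zero    d f _   = ≤-reflexive (*-zeroʳ d)
*∣support∣≤∑ (suc n) d f f≥d with f fzero | f≥d fzero | *∣support∣≤∑ n d (f ∘ fsuc) (f≥d ∘ fsuc)
... | zero  | _    | rest = rest
... | suc _ | d≤f0 | rest = ≤-trans (≤-reflexive (*-suc d _)) (+-mono-≤ (d≤f0 (s≤s z≤n)) rest)

∑≤*∣support∣ : ∀ n e (f : Fin n → ℕ) → (∀ x → f x ≤ e) → ∑[ x < n ] f x ≤ e * ∣ support f ∣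
∑≤*∣support∣ zero    e f _   = z≤n
∑≤*∣support∣ (suc n) e f f≤e with f fzero | f≤e fzero | ∑≤*∣support∣ n e (f ∘ fsuc) (f≤e ∘ fsuc)
... | zero  | _    | rest = rest
... | suc _ | f0≤e | rest = ≤-trans (+-mono-≤ f0≤e rest) (≤-reflexive (sym (*-suc e _)))

_∈ₑ_ : Fin n → Edge n → Set
x ∈ₑ e = x ≡ proj₁ e ⊎ x ≡ proj₂ e

_∈ₑ?_ : (x : Fin n) → Decidable (x ∈ₑ_)
x ∈ₑ? e = (x ≟ proj₁ e) ⊎-dec (x ≟ proj₂ e)

Loopless : Edge n → Set
Loopless e = proj₁ e ≢ proj₂ e

deg-∷ : (e : Edge n) (H : List (Edge n)) (x : Fin n) → deg (e ∷ H) x ≡ deg [ e ] x + deg H x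
deg-∷ e H x with does (x ∈ₑ? e)
... | true  = refl
... | false = refl

deg-∷-endpoint : {e : Edge n} (H : List (Edge n)) {x : Fin n} → x ∈ₑ e → deg (e ∷ H) x ≡ suc (deg H x)
deg-∷-endpoint H x∈e = cong length (filter-accept (_ ∈ₑ?_) {xs = H} x∈e)

deg-single : {u v : Fin n} → u ≢ v → (x : Fin n) → deg [ (u , v) ] x ≡ indicator u x + indicator v x
deg-single {u = u} {v} u≢v x with x ≟ u | x ≟ v
... | yes refl | yes refl = contradiction refl u≢v
... | yes _    | no _     = refl
... | no _     | yes _    = refl
... | no _     | no _     = refl

endpoint⇒1≤deg : {H : List (Edge n)} {e : Edge n} {x : Fin n} → e ∈ H → x ∈ₑ e → 1 ≤ deg H x
endpoint⇒1≤deg e∈H x∈e = filter-some (_ ∈ₑ?_) (lose e∈H x∈e)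

1≤deg⇒endpoint : (H : List (Edge n)) (x : Fin n) → 1 ≤ deg H x → ∃ λ f → f ∈ H × x ∈ₑ f
1≤deg⇒endpoint H x 1≤deg with filter (x ∈ₑ?_) H in eq
... | f ∷ _ = f , ∈-filter⁻ (x ∈ₑ?_) {xs = H} (subst (f ∈_) (sym eq) (here refl))

∑-deg : (H : List (Edge n)) → All Loopless H → ∑[ x < n ] deg H x ≡ 2 * length H
∑-deg {n} []            All.[]                 = sum-replicate-zero n
∑-deg {n} ((u , v) ∷ H) (u≢v All.∷ H-loopless) = begin
  ∑[ x < n ] deg ((u , v) ∷ H) x                            ≡⟨ sum-cong-≗ (deg-∷ (u , v) H) ⟩
  ∑[ x < n ] (deg [ (u , v) ] x + deg H x)                   ≡⟨ ∑-distrib-+ (deg [ (u , v) ]) (deg H) ⟩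
  ∑[ x < n ] deg [ (u , v) ] x + ∑[ x < n ] deg H x          ≡⟨ cong₂ _+_ ∑-deg-single (∑-deg H H-loopless) ⟩
  2 + 2 * length H                                          ≡⟨ sym (*-suc 2 (length H)) ⟩
  2 * length ((u , v) ∷ H)                                  ∎
  where
  open ≡-Reasoning
  ∑-deg-single : ∑[ x < n ] deg [ (u , v) ] x ≡ 2
  ∑-deg-single = trans (sum-cong-≗ (deg-single u≢v))
    (trans (∑-distrib-+ (indicator u) (indicator v)) (cong₂ _+_ (∑-indicator n u) (∑-indicator n v)))

_⊆ᵛ_ : Edge n → Subset n → Set
e ⊆ᵛ S = proj₁ e ∈ˢ S × proj₂ e ∈ˢ S

_⊆ᵛ?_ : (e : Edge n) (S : Subset n) → Dec (e ⊆ᵛ S)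
e ⊆ᵛ? S = (proj₁ e ∈? S) ×-dec (proj₂ e ∈? S)

length≤inducedEdges : (G : Graph n) {H K : List (Edge n)} (S : Subset n) →
                      H ⊆ K → K ↭ edges G → All (_⊆ᵛ S) H → length H ≤ inducedEdges G S
length≤inducedEdges G S H⊆K K↭G H⊆S = subst (_≤ inducedEdges G S)
  (cong length (filter-all (_⊆ᵛ? S) H⊆S))
  (length-filter-mono (_⊆ᵛ? S) H⊆K K↭G)

minDeg≤2*arboricity : (G : Graph n) {α d : ℕ} {H K : List (Edge n)} →
  ArbBound G α → H ⊆ K → K ↭ edges G → 1 ≤ length H →
  (∀ x → 1 ≤ deg H x → d ≤ deg H x) → d ≤ 2 * α
minDeg≤2*arboricity {n} G {α} {d} {H} arb H⊆K K↭G 1≤|H| d≤deg =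
  *-cancelʳ-≤ d (2 * α) c {{>-nonZero (≤-trans (s≤s z≤n) 2≤c)}} (begin
    d * c               ≤⟨ d*c≤2|H| ⟩
    2 * length H        ≤⟨ *-monoʳ-≤ 2 (≤-trans H⊆G[S] (ceilDiv≤⇒≤* _ α (∸-monoˡ-≤ 1 2≤c) (arb S 2≤c))) ⟩
    2 * (α * (c ∸ 1))   ≤⟨ *-monoʳ-≤ 2 (*-monoʳ-≤ α (m∸n≤m c 1)) ⟩
    2 * (α * c)         ≡⟨ sym (*-assoc 2 α c) ⟩
    2 * α * c           ∎)
  where
  open ≤-Reasoning
  S = support (deg H)
  c = ∣ S ∣
  handshake : ∑[ x < n ] deg H x ≡ 2 * length H
  handshake = ∑-deg H (All-resp-⊆ H⊆K (All-resp-↭ (↭-sym K↭G) (noLoops G)))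
  d*c≤2|H| : d * c ≤ 2 * length H
  d*c≤2|H| = subst (d * c ≤_) handshake (*∣support∣≤∑ n d (deg H) d≤deg)
  2≤c : 2 ≤ c
  2≤c = *-cancelˡ-≤ (length H) {{>-nonZero 1≤|H|}}
          (subst₂ _≤_ (*-comm 2 (length H)) refl
            (subst (_≤ length H * c) handshake
              (∑≤*∣support∣ n (length H) (deg H) (λ x → length-filter (x ∈ₑ?_) H))))
  H⊆G[S] : length H ≤ inducedEdges G S
  H⊆G[S] = length≤inducedEdges G S H⊆K K↭G (All.tabulate λ e∈H →
             ∈-support (deg H) (endpoint⇒1≤deg e∈H (inj₁ refl)) ,
             ∈-support (deg H) (endpoint⇒1≤deg e∈H (inj₂ refl)))

Φ-minimal⇒Φ≤deg : {H : List (Edge n)} {e : Edge n} → (∀ f → f ∈ H → Φ H e ≤ Φ H f) →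
                  ∀ x → 1 ≤ deg H x → Φ H e ≤ deg H x
Φ-minimal⇒Φ≤deg {H = H} Φ-min x 1≤deg with 1≤deg⇒endpoint H x 1≤deg
... | f , f∈H , inj₁ refl = ≤-trans (Φ-min f f∈H) (m⊓n≤m _ _)
... | f , f∈H , inj₂ refl = ≤-trans (Φ-min f f∈H) (m⊓n≤n _ _)

palette≡ : (ord : List (Edge n)) (i : Fin (length ord)) →
           let H = drop (suc (toℕ i)) ord; e = lookup ord i in
           palette ord i ≡ deg H (proj₁ e) + suc (deg H (proj₂ e))
palette≡ ord i = trans
  (cong (λ H → deg H (proj₁ e) + deg H (proj₂ e) ∸ 1) (drop-lookup ord i))
  (cong₂ (λ a b → a + b ∸ 1) (deg-∷-endpoint H (inj₁ refl)) (deg-∷-endpoint H (inj₂ refl)))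
  where
  H = drop (suc (toℕ i)) ord
  e = lookup ord i

availableColor : (ord : List (Edge n)) (i : Fin (length ord)) (χ : Fin (length ord) → ℕ) →
                 AvailableColor ord i χ
availableColor ord i χ with fresh-in-range (palette ord i) forbidden forbidden<palette
  where
  e = lookup ord i
  k = suc (toℕ i)
  forbidden = valuesFrom (proj₁ e ∈ₑ?_) k ord χ ++ valuesFrom (proj₂ e ∈ₑ?_) k ord χ
  forbidden<palette : length forbidden < palette ord i
  forbidden<palette = subst₂ _<_
    (sym (trans (length-++ (valuesFrom (proj₁ e ∈ₑ?_) k ord χ))
                (cong₂ _+_ (length-valuesFrom _ k ord χ) (length-valuesFrom _ k ord χ))))
    (sym (palette≡ ord i))
    (+-monoʳ-< _ ≤-refl)
... | c , 1≤c , c≤palette , c∉forbidden =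
  c , 1≤c , c≤palette , λ j i<j shares χj≡c → c∉forbidden (subst (_∈ _) χj≡c
    ([ (λ u∈f → ∈-++⁺ˡ (∈-valuesFrom _ _ ord χ j i<j u∈f))
     , (λ v∈f → ∈-++⁺ʳ _ (∈-valuesFrom _ _ ord χ j i<j v∈f))
     ]′ (assocˡ shares)))

palette≤ : (G : Graph n) (α : ℕ) → IsArboricity G α → (ord : List (Edge n)) → IsPhaseI G ord →
           (i : Fin (length ord)) → palette ord i ≤ maxDeg G + 2 * α ∸ 1
palette≤ G α (arb , _) ord (ord↭G , Φ-min) i =
  ∸-monoˡ-≤ 1 (m≤o⇒n≤o⇒m⊓n≤p⇒m+n≤o+p (deg≤Δ (proj₁ e)) (deg≤Δ (proj₂ e)) Φ≤2α)
  where
  H = drop (toℕ i) ord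
  e = lookup ord i
  H⊆ord = drop-⊆ (toℕ i) ord
  deg≤Δ : ∀ x → deg H x ≤ maxDeg G
  deg≤Δ x = ≤-trans (length-filter-mono (x ∈ₑ?_) H⊆ord ord↭G)
                    (≤-foldr-⊔ (deg (edges G)) (∈-allFin x))
  Φ≤2α : Φ H e ≤ 2 * α
  Φ≤2α = minDeg≤2*arboricity G arb H⊆ord ord↭G
    (subst (λ L → 1 ≤ length L) (sym (drop-lookup ord i)) (s≤s z≤n))
    (Φ-minimal⇒Φ≤deg (Φ-min i))

lemmaA2 : ∀ {n} (G : Graph n) (α : ℕ) → IsArboricity G α →
          (ord : List (Edge n)) → IsPhaseI G ord →
          (i : Fin (length ord)) →
          ((χ : Fin (length ord) → ℕ) → PhaseIIStateBefore ord i χ → AvailableColor ord i χ)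
          × (palette ord i ≤ maxDeg G + 2 * α ∸ 1)
lemmaA2 G α arb ord phaseI i = (λ χ _ → availableColor ord i χ) , palette≤ G α arb ord phaseI i
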